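{- Let $n\ge2$, let $f=f_0x_1^n+\dots+f_nx_2^n$ be a binary $n$-ic form with integer coefficients and $f_0\ne0$, and let $(M,N)$ be a based balanced pair of modules for $f$ with associated matrices $(A_1,A_2)$. Write elements of $M_{f_0}=M\otimes\mathbb{Z}[1/f_0]$ as row vectors and elements of $N_{f_0}=N\otimes\mathbb{Z}[1/f_0]$ as column vectors (in the given bases). Then $\theta$ acts on $M_{f_0}$ by right multiplication by $-A_2A_1^{ -1}$ and on $N_{f_0}$ by left multiplication by $-A_1^{ -1}A_2$.
   Context: Let $F=f$ and $\zeta_k=f_0\theta^k+\dots+f_{k-1}\theta$. $R_f$ is the $\mathbb{Z}$-span of $1,\zeta_1,\dots,\zeta_{n-1}$ in $\mathbb{Q}[\theta]/(F(\theta,1))$ (a ring), so $R_f\otimes\mathbb{Z}[1/f_0]=\mathbb{Z}[1/f_0][\theta]/(F(\theta,1))$ acts on $M_{f_0},N_{f_0}$. $I_f$ is the $R_f$-module spanned over $\mathbb{Z}$ by $1,\theta,\dots,\theta^{n-3},\zeta_{n-2},\zeta_{n-1}$ (for $n=2$: $f_0,f_0\theta+f_1$), with the map $I_f\to\mathbb{Z}^2$, $\sum r_j\theta^j\mapsto(r_{n-1}/f_0,\ -(r_{n-2}-f_1r_{n-1}/f_0)/f_0)$. A based balanced pair consists of $R_f$-modules $M,N$ with $\mathbb{Z}$-bases $(m_j),(n_k)$ and an $R_f$-module map $M\otimes_{R_f}N\to I_f$ such that, with $A_i$ the matrix whose $(j,k)$ entry is the $i$-th coordinate of the image of $m_j\otimes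 n_k$ in $\mathbb{Z}^2$, $\det(A_1x_1+A_2x_2)=f$. -}

module Defs where

open import Data.Nat as ℕ using (ℕ; zero; suc; _∸_)
open import Data.Integer as ℤ using (ℤ; +_; +[1+_]; -[1+_])
open import Data.Rational using (ℚ; mkℚ; 0ℚ; 1ℚ; _+_; _*_; _-_; -_; 1/_; _/_)
open import Data.Fin using (Fin; zero; suc; toℕ; fromℕ<; punchIn)
open import Data.Product using (Σ; ∃; _×_)
open import Relation.Binary.PropositionalEquality using (_≡_)
open import Relation.Nullary using (yes; no)
open import Data.Bool using (Bool; true; false; if_then_else_; _∧_)

ι : ℤ → ℚ
ι z = z / 1

-- total inverse on ℚ (0 ↦ 0); only ever applied to f₀ ≠ 0
inv : ℚ → ℚ
inv (mkℚ (+ zero) _ _) = 0ℚ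
inv p@(mkℚ +[1+ _ ] _ _) = 1/ p
inv p@(mkℚ -[1+ _ ] _ _) = 1/ p

_^ℚ_ : ℚ → ℕ → ℚ
q ^ℚ zero = 1ℚ
q ^ℚ suc k = q * (q ^ℚ k)

Σℚ : ∀ {k} → (Fin k → ℚ) → ℚ
Σℚ {zero} v = 0ℚ
Σℚ {suc k} v = v zero + Σℚ (λ i → v (suc i))

at : ∀ {a} {A : Set a} {k} → (Fin k → A) → A → ℕ → A
at {k = k} v d j with j ℕ.<? k
... | yes p = v (fromℕ< p)
... | no _ = d

_≈_ : ∀ {k} → (Fin k → ℚ) → (Fin k → ℚ) → Set
u ≈ v = ∀ i → u i ≡ v i

_≈₂_ : ∀ {r c} → (Fin r → Fin c → ℚ) → (Fin r → Fin c → ℚ) → Set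
A ≈₂ B = ∀ i j → A i j ≡ B i j

δ : ∀ {k} → Fin k → Fin k → ℚ
δ i j = if toℕ i ℕ.≡ᵇ toℕ j then 1ℚ else 0ℚ

Mat : ℕ → ℕ → Set
Mat r c = Fin r → Fin c → ℚ

_·_ : ∀ {r s t} → Mat r s → Mat s t → Mat r t
(A · B) i k = Σℚ (λ j → A i j * B j k)

det : ∀ {k} → Mat k k → ℚ
det {zero} A = 1ℚ
det {suc k} A =
  Σℚ (λ j → ((- 1ℚ) ^ℚ toℕ j) * (A zero j * det (λ r c → A (suc r) (punchIn j c))))

InZinv : ℚ → ℚ → Set
InZinv d q = ∃ λ (k : ℕ) → ∃ λ (z : ℤ) → q * (d ^ℚ k) ≡ ι z

-- The binary n-ic form f = Σ_i f_i x₁^(n-i) x₂^i, f : Fin (suc n) → ℤ.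
-- K = ℚ[θ]/(F(θ,1)), F(θ,1) = f₀θⁿ + f₁θⁿ⁻¹ + … + fₙ; elements are
-- coefficient vectors w.r.t. 1, θ, …, θⁿ⁻¹.

module Form (n : ℕ) (f : Fin (suc n) → ℤ) where

  fq : ℕ → ℚ
  fq j = ι (at f (+ 0) j)

  evalForm : ℚ → ℚ → ℚ
  evalForm x₁ x₂ = Σℚ (λ i → ι (f i) * ((x₁ ^ℚ (n ∸ toℕ i)) * (x₂ ^ℚ toℕ i)))

  K : Set
  K = Fin n → ℚ

  -- θ^j (basis vector), for j < n
  θ^ : ℕ → K
  θ^ j i = if toℕ i ℕ.≡ᵇ j then 1ℚ else 0ℚ

  oneK : K
  oneK = θ^ 0

  θK : K
  θK = θ^ 1

  _+K_ : K → K → K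
  (u +K v) i = u i + v i

  _⋆_ : ℚ → K → K
  (q ⋆ v) i = q * v i

  -- multiplication by θ, reducing θⁿ = -(f₁θⁿ⁻¹ + … + fₙ)/f₀
  mulθ : K → K
  mulθ v i =
    (if toℕ i ℕ.≡ᵇ 0 then 0ℚ else at v 0ℚ (toℕ i ∸ 1))
    - (at v 0ℚ (n ∸ 1) * (fq (n ∸ toℕ i) * inv (fq 0)))

  iterθ : ℕ → K → K
  iterθ zero v = v
  iterθ (suc j) v = mulθ (iterθ j v)

  _*K_ : K → K → K
  (a *K b) i = Σℚ (λ j → a j * iterθ (toℕ j) b i)

  -- ζ_k = f₀θ^k + … + f_{k-1}θ  (coefficient of θ^i is f_{k-i} for 1 ≤ i ≤ k)
  ζ : ℕ → K
  ζ k i = if (1 ℕ.≤ᵇ toℕ i) ∧ (toℕ i ℕ.≤ᵇ k) then fq (k ∸ toℕ i) else 0ℚ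

  -- ℤ-basis 1, ζ₁, …, ζ_{n-1} of R_f
  bR : Fin n → K
  bR k = if toℕ k ℕ.≡ᵇ 0 then oneK else ζ (toℕ k)

  toKℚ : (Fin n → ℚ) → K
  toKℚ c i = Σℚ (λ k → c k * bR k i)

  toK : (Fin n → ℤ) → K
  toK c = toKℚ (λ k → ι (c k))

  -- ℤ-basis of I_f : 1, θ, …, θ^{n-3}, ζ_{n-2}, ζ_{n-1}; for n = 2 : f₀, f₀θ + f₁
  bI : Fin n → K
  bI j =
    if n ℕ.≡ᵇ 2
    then (if toℕ j ℕ.≡ᵇ 0 then fq 0 ⋆ θ^ 0 else ((fq 0 ⋆ θ^ 1) +K (fq 1 ⋆ θ^ 0)))
    else (if suc (suc (toℕ j)) ℕ.≤ᵇ n ∸ 1 then θ^ (toℕ j) else ζ (toℕ j))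

  InIf : K → Set
  InIf r = ∃ λ (c : Fin n → ℤ) → ∀ i → r i ≡ Σℚ (λ j → ι (c j) * bI j i)

  -- the map I_f → ℤ², Σ r_j θ^j ↦ (r_{n-1}/f₀, -(r_{n-2} - f₁ r_{n-1}/f₀)/f₀)
  φ₁ : K → ℚ
  φ₁ r = at r 0ℚ (n ∸ 1) * inv (fq 0)

  φ₂ : K → ℚ
  φ₂ r = - ((at r 0ℚ (n ∸ 2) - (fq 1 * (at r 0ℚ (n ∸ 1) * inv (fq 0)))) * inv (fq 0))

  -- R_f-modules with a ℤ-basis of rank m.
  -- act k j : coordinates (in the basis (e_l)) of bR k · e_j.

  module _ {m : ℕ} (act : Fin n → Fin m → Fin m → ℤ) where

    actℚ : (Fin n → ℚ) → (Fin m → ℚ) → (Fin m → ℚ)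
    actℚ c x l = Σℚ (λ k → c k * Σℚ (λ j → x j * ι (act k j l)))

    actℤ : (Fin n → ℤ) → (Fin m → ℤ) → (Fin m → ℚ)
    actℤ c x = actℚ (λ k → ι (c k)) (λ j → ι (x j))

  -- the ℤ-linear extension defines an R_f-module structure, i.e. a ring
  -- homomorphism R_f → End_ℤ(ℤ^m) (additivity is automatic)
  record IsRfModule {m : ℕ} (act : Fin n → Fin m → Fin m → ℤ) : Set where
    field
      unit : ∀ (c : Fin n → ℤ) → toK c ≈ oneK →
             ∀ (x : Fin m → ℤ) → actℤ act c x ≈ (λ j → ι (x j))
      mult : ∀ (c d e : Fin n → ℤ) → (toK c *K toK d) ≈ toK e →
             ∀ (x : Fin m → ℤ) →
             actℚ act (λ k → ι (c k)) (actℤ act d x) ≈ actℤ act e x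

  -- based balanced pair of rank m (ranks of M and N must agree for
  -- det(A₁x₁ + A₂x₂) to make sense)
  record BasedBalancedPair (m : ℕ) : Set where
    field
      actM : Fin n → Fin m → Fin m → ℤ
      actN : Fin n → Fin m → Fin m → ℤ
      isModM : IsRfModule actM
      isModN : IsRfModule actN
      -- β j k = image of m_j ⊗ n_k in I_f ⊂ K
      β : Fin m → Fin m → K
      β∈If : ∀ j k → InIf (β j k)

    B : (Fin m → ℚ) → (Fin m → ℚ) → K
    B x y i = Σℚ (λ j → Σℚ (λ k → x j * (y k * β j k i)))

    A₁ : Mat m m
    A₁ j k = φ₁ (β j k)

    A₂ : Mat m m
    A₂ j k = φ₂ (β j k)

    field
      linM : ∀ (c : Fin n → ℤ) (x y : Fin m → ℤ) →
             B (actℤ actM c x) (λ k → ι (y k)) ≈ (toK c *K B (λ j → ι (x j)) (λ k → ι (y k)))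
      linN : ∀ (c : Fin n → ℤ) (x y : Fin m → ℤ) →
             B (λ j → ι (x j)) (actℤ actN c y) ≈ (toK c *K B (λ j → ι (x j)) (λ k → ι (y k)))
      -- det(A₁x₁ + A₂x₂) = f as polynomials (checked on all rational points)
      detf : ∀ (x₁ x₂ : ℚ) → det (λ j k → (A₁ j k * x₁) + (A₂ j k * x₂)) ≡ evalForm x₁ x₂

module Submission where

-- The whole argument rests on one identity in K = ℚ[θ]/(F(θ,1)):
-- for n ≥ 2 the coordinate maps φ₁, φ₂ : K → ℚ satisfy φ₁(θ r) = -φ₂(r).
-- Write B(x, y) ∈ K for the pairing. Balancedness gives B(θx, n_q) =
-- θ B(x, n_q), and applying φ₁ and the identity yields, column by column,
--     (θx)·A₁ = -x·A₂,   and symmetrically   A₁·(θy) = -A₂·y;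
-- multiplying by A₁⁻¹ gives the claim.
-- The integrality hypotheses (coordinates in ℤ[1/f₀]) are not needed:
-- both identities hold for all rational coordinate vectors.

open import Defs
open import Data.Nat using (ℕ; suc; zero; _≤_; s≤s; z≤n; _∸_)
import Data.Nat as ℕ
import Data.Nat.Properties as ℕP
open import Data.Integer using (ℤ; 0ℤ; 1ℤ)
open import Data.Rational using (ℚ; _*_; -_; _+_; _-_; 0ℚ; 1ℚ)
import Data.Rational.Properties as ℚP
open import Data.Rational.Solver using (module +-*-Solver)
open import Data.Fin using (Fin; zero; suc; toℕ; fromℕ<)
import Data.Fin.Properties as FinP
open import Data.Product using (_×_; _,_)
open import Data.Empty using (⊥-elim)
open import Data.Bool using (true; false; if_then_else_)
open import Relation.Nullary using (yes; no)
open import Relation.Binary.PropositionalEquality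
open ≡-Reasoning
open +-*-Solver

Σ-cong : ∀ {k} {u v : Fin k → ℚ} → u ≈ v → Σℚ u ≡ Σℚ v
Σ-cong {zero} h = refl
Σ-cong {suc k} h = cong₂ _+_ (h zero) (Σ-cong (λ i → h (suc i)))

Σ-zero : ∀ {k} → Σℚ {k} (λ _ → 0ℚ) ≡ 0ℚ
Σ-zero {zero} = refl
Σ-zero {suc k} = trans (ℚP.+-identityˡ _) (Σ-zero {k})

Σ-+ : ∀ {k} (u v : Fin k → ℚ) → Σℚ (λ i → u i + v i) ≡ Σℚ u + Σℚ v
Σ-+ {zero} u v = refl
Σ-+ {suc k} u v =
  trans (cong (u zero + v zero +_) (Σ-+ (λ i → u (suc i)) (λ i → v (suc i))))
    (solve 4 (λ a b c d → (a :+ b) :+ (c :+ d) := (a :+ c) :+ (b :+ d)) refl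
       (u zero) (v zero) _ _)

Σ-*ˡ : ∀ {k} a (u : Fin k → ℚ) → Σℚ (λ i → a * u i) ≡ a * Σℚ u
Σ-*ˡ {zero} a u = sym (ℚP.*-zeroʳ a)
Σ-*ˡ {suc k} a u =
  trans (cong (a * u zero +_) (Σ-*ˡ a (λ i → u (suc i))))
    (sym (ℚP.*-distribˡ-+ a (u zero) _))

Σ-*ʳ : ∀ {k} a (u : Fin k → ℚ) → Σℚ (λ i → u i * a) ≡ Σℚ u * a
Σ-*ʳ a u = trans (Σ-cong (λ i → ℚP.*-comm (u i) a)) (trans (Σ-*ˡ a u) (ℚP.*-comm a _))

Σ-neg : ∀ {k} (u : Fin k → ℚ) → Σℚ (λ i → - u i) ≡ - Σℚ u
Σ-neg {zero} u = refl
Σ-neg {suc k} u =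
  trans (cong (- u zero +_) (Σ-neg (λ i → u (suc i))))
    (sym (ℚP.neg-distrib-+ (u zero) _))

Σ-swap : ∀ {k l} (w : Fin k → Fin l → ℚ) →
  Σℚ (λ i → Σℚ (λ j → w i j)) ≡ Σℚ (λ j → Σℚ (λ i → w i j))
Σ-swap {zero} {l} w = sym (Σ-zero {l})
Σ-swap {suc k} w =
  trans (cong (Σℚ (w zero) +_) (Σ-swap (λ i → w (suc i)))) (sym (Σ-+ (w zero) _))

infix 8 _∙_
_∙_ : ∀ {k} → (Fin k → ℚ) → (Fin k → ℚ) → ℚ
u ∙ v = Σℚ (λ i → u i * v i)

∙-congˡ : ∀ {k} {u u' : Fin k → ℚ} (v : Fin k → ℚ) → u ≈ u' → u ∙ v ≡ u' ∙ v
∙-congˡ v h = Σ-cong (λ i → cong (_* v i) (h i))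

∙-congʳ : ∀ {k} (u : Fin k → ℚ) {v v' : Fin k → ℚ} → v ≈ v' → u ∙ v ≡ u ∙ v'
∙-congʳ u h = Σ-cong (λ i → cong (u i *_) (h i))

∙-comm : ∀ {k} (u v : Fin k → ℚ) → u ∙ v ≡ v ∙ u
∙-comm u v = Σ-cong (λ i → ℚP.*-comm (u i) (v i))

∙-negˡ : ∀ {k} (u v : Fin k → ℚ) → (λ i → - u i) ∙ v ≡ - (u ∙ v)
∙-negˡ u v = trans (Σ-cong (λ i → sym (ℚP.neg-distribˡ-* (u i) (v i)))) (Σ-neg (λ i → u i * v i))

∙-negʳ : ∀ {k} (u v : Fin k → ℚ) → u ∙ (λ i → - v i) ≡ - (u ∙ v)
∙-negʳ u v = trans (Σ-cong (λ i → sym (ℚP.neg-distribʳ-* (u i) (v i)))) (Σ-neg (λ i → u i * v i))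

∙-assoc : ∀ {k l} (a : Fin k → ℚ) (b : Fin k → Fin l → ℚ) (g : Fin l → ℚ) →
  (λ p → a ∙ (λ q → b q p)) ∙ g ≡ a ∙ (λ q → b q ∙ g)
∙-assoc a b g = begin
  Σℚ (λ p → Σℚ (λ q → a q * b q p) * g p)    ≡⟨ Σ-cong (λ p → sym (Σ-*ʳ (g p) (λ q → a q * b q p))) ⟩
  Σℚ (λ p → Σℚ (λ q → a q * b q p * g p))    ≡⟨ Σ-swap (λ p q → a q * b q p * g p) ⟩
  Σℚ (λ q → Σℚ (λ p → a q * b q p * g p))    ≡⟨ Σ-cong (λ q → Σ-cong (λ p → ℚP.*-assoc (a q) (b q p) (g p))) ⟩
  Σℚ (λ q → Σℚ (λ p → a q * (b q p * g p)))  ≡⟨ Σ-cong (λ q → Σ-*ˡ (a q) (λ p → b q p * g p)) ⟩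
  a ∙ (λ q → b q ∙ g)                         ∎

∙-exchange : ∀ {k l} (u : Fin k → ℚ) (v : Fin l → ℚ) (g : Fin l → Fin k → ℚ) →
  u ∙ (λ q → v ∙ (λ j → g j q)) ≡ v ∙ (λ j → u ∙ g j)
∙-exchange u v g = begin
  u ∙ (λ q → v ∙ (λ j → g j q))   ≡⟨ ∙-comm u _ ⟩
  (λ q → v ∙ (λ j → g j q)) ∙ u   ≡⟨ ∙-assoc v g u ⟩
  v ∙ (λ j → g j ∙ u)             ≡⟨ ∙-congʳ v (λ j → ∙-comm (g j) u) ⟩
  v ∙ (λ j → u ∙ g j)             ∎

∙-δʳ : ∀ {k} (v : Fin k → ℚ) l → v ∙ (λ p → δ p l) ≡ v l
∙-δʳ {suc k} v zero =
  trans (cong (v zero * 1ℚ +_) (trans (Σ-cong (λ i → ℚP.*-zeroʳ (v (suc i)))) (Σ-zero {k})))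
    (solve 1 (λ a → a :* con 1ℚ :+ con 0ℚ := a) refl (v zero))
∙-δʳ {suc k} v (suc l) =
  trans (cong (v zero * 0ℚ +_) (∙-δʳ (λ i → v (suc i)) l))
    (solve 2 (λ a b → a :* con 0ℚ :+ b := b) refl (v zero) _)

∙-δˡ : ∀ {k} (v : Fin k → ℚ) l → (δ l) ∙ v ≡ v l
∙-δˡ {suc k} v zero =
  trans (cong (1ℚ * v zero +_) (trans (Σ-cong (λ i → ℚP.*-zeroˡ (v (suc i)))) (Σ-zero {k})))
    (solve 1 (λ a → con 1ℚ :* a :+ con 0ℚ := a) refl (v zero))
∙-δˡ {suc k} v (suc l) =
  trans (cong (0ℚ * v zero +_) (∙-δˡ (λ i → v (suc i)) l))
    (solve 2 (λ a b → con 0ℚ :* a :+ b := b) refl (v zero) _)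

e : ∀ {k} → Fin k → Fin k → ℤ
e j i = if toℕ j ℕ.≡ᵇ toℕ i then 1ℤ else 0ℤ

ι-e : ∀ {k} (j i : Fin k) → ι (e j i) ≡ δ j i
ι-e j i with toℕ j ℕ.≡ᵇ toℕ i
... | true = refl
... | false = refl

∙-e : ∀ {k} (l : Fin k) (v : Fin k → ℚ) → (λ p → ι (e l p)) ∙ v ≡ v l
∙-e l v = trans (∙-congˡ v (ι-e l)) (∙-δˡ v l)

infixl 7 _⊙_ _⊛_
_⊙_ : ∀ {r c} → (Fin r → ℚ) → Mat r c → (Fin c → ℚ)
(x ⊙ A) l = x ∙ (λ j → A j l)

_⊛_ : ∀ {r c} → Mat r c → (Fin c → ℚ) → (Fin r → ℚ)
(A ⊛ y) l = A l ∙ y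

negM : ∀ {r c} → Mat r c → Mat r c
negM A j l = - A j l

row-solve : ∀ {m} (A B A⁻ : Mat m m) → (A · A⁻) ≈₂ δ → (x x' : Fin m → ℚ) →
  (x' ⊙ A) ≈ (λ q → - (x ⊙ B) q) → x' ≈ (x ⊙ negM (B · A⁻))
row-solve A B A⁻ AA⁻≈1 x x' rel l = sym (begin
  x ∙ (λ j → - (B · A⁻) j l)                  ≡⟨ ∙-negʳ x _ ⟩
  - (x ∙ (λ j → B j ∙ (λ q → A⁻ q l)))         ≡⟨ cong -_ (sym (∙-assoc x B _)) ⟩
  - ((x ⊙ B) ∙ (λ q → A⁻ q l))                 ≡⟨ sym (∙-negˡ (x ⊙ B) _) ⟩
  (λ q → - (x ⊙ B) q) ∙ (λ q → A⁻ q l)         ≡⟨ ∙-congˡ _ (λ q → sym (rel q)) ⟩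
  (x' ⊙ A) ∙ (λ q → A⁻ q l)                   ≡⟨ ∙-assoc x' A _ ⟩
  x' ∙ (λ p → (A · A⁻) p l)                   ≡⟨ ∙-congʳ x' (λ p → AA⁻≈1 p l) ⟩
  x' ∙ (λ p → δ p l)                          ≡⟨ ∙-δʳ x' l ⟩
  x' l                                        ∎)

column-solve : ∀ {m} (A B A⁻ : Mat m m) → (A⁻ · A) ≈₂ δ → (y y' : Fin m → ℚ) →
  (A ⊛ y') ≈ (λ q → - (B ⊛ y) q) → y' ≈ (negM (A⁻ · B) ⊛ y)
column-solve A B A⁻ A⁻A≈1 y y' rel l = begin
  y' l                                        ≡⟨ sym (∙-δˡ y' l) ⟩
  δ l ∙ y'                                    ≡⟨ ∙-congˡ y' (λ p → sym (A⁻A≈1 l p)) ⟩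
  (λ p → (A⁻ · A) l p) ∙ y'                   ≡⟨ ∙-assoc (A⁻ l) A y' ⟩
  A⁻ l ∙ (A ⊛ y')                             ≡⟨ ∙-congʳ (A⁻ l) rel ⟩
  A⁻ l ∙ (λ q → - (B ⊛ y) q)                   ≡⟨ ∙-negʳ (A⁻ l) _ ⟩
  - (A⁻ l ∙ (λ q → B q ∙ y))                   ≡⟨ cong -_ (sym (∙-assoc (A⁻ l) B y)) ⟩
  - ((λ k → (A⁻ · B) l k) ∙ y)                 ≡⟨ sym (∙-negˡ (λ k → (A⁻ · B) l k) y) ⟩
  (negM (A⁻ · B) ⊛ y) l                        ∎

record Linear {k} (L : (Fin k → ℚ) → ℚ) : Set where
  field
    lin-cong : ∀ {u v} → u ≈ v → L u ≡ L v
    lin-comb : ∀ a u v → L (λ i → a * u i + v i) ≡ a * L u + L v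
    lin-zero : L (λ _ → 0ℚ) ≡ 0ℚ
open Linear

linear-∙ : ∀ {k m} {L : (Fin k → ℚ) → ℚ} → Linear L → (x : Fin m → ℚ) (w : Fin m → Fin k → ℚ) →
  L (λ i → x ∙ (λ j → w j i)) ≡ x ∙ (λ j → L (w j))
linear-∙ {m = zero} lin x w = lin-zero lin
linear-∙ {m = suc m} lin x w =
  trans (lin-comb lin (x zero) (w zero) _)
    (cong (x zero * _ +_) (linear-∙ lin (λ j → x (suc j)) (λ j → w (suc j))))

proj-linear : ∀ {k} (i : Fin k) → Linear (λ v → v i)
lin-cong (proj-linear i) h = h i
lin-comb (proj-linear i) a u v = refl
lin-zero (proj-linear i) = refl

zero-linear : ∀ {k} → Linear {k} (λ _ → 0ℚ)
lin-cong zero-linear h = refl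
lin-comb zero-linear a u v = solve 1 (λ a → con 0ℚ := a :* con 0ℚ :+ con 0ℚ) refl a
lin-zero zero-linear = refl

at-linear : ∀ {k} t → Linear {k} (λ v → at v 0ℚ t)
lin-cong (at-linear {k} t) h with t ℕ.<? k
... | yes _ = h _
... | no _ = refl
lin-comb (at-linear {k} t) a u v with t ℕ.<? k
... | yes _ = refl
... | no _ = solve 1 (λ a → con 0ℚ := a :* con 0ℚ :+ con 0ℚ) refl a
lin-zero (at-linear {k} t) with t ℕ.<? k
... | yes _ = refl
... | no _ = refl

at-< : ∀ {k} (v : Fin k → ℚ) d j (p : j ℕ.< k) → at v d j ≡ v (fromℕ< p)
at-< {k} v d j p with j ℕ.<? k
... | yes q = cong (λ z → v (fromℕ< z)) (ℕP.<-irrelevant q p)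
... | no ¬q = ⊥-elim (¬q p)

if-linear : ∀ {k} b {L₁ L₂ : (Fin k → ℚ) → ℚ} → Linear L₁ → Linear L₂ →
  Linear (λ v → if b then L₁ v else L₂ v)
if-linear true l₁ l₂ = l₁
if-linear false l₁ l₂ = l₂

sub-linear : ∀ {k} {L₁ L₂ : (Fin k → ℚ) → ℚ} → Linear L₁ → Linear L₂ → Linear (λ v → L₁ v - L₂ v)
lin-cong (sub-linear l₁ l₂) h = cong₂ _-_ (lin-cong l₁ h) (lin-cong l₂ h)
lin-comb (sub-linear l₁ l₂) a u v =
  trans (cong₂ _-_ (lin-comb l₁ a u v) (lin-comb l₂ a u v))
    (solve 5 (λ a b c d e → (a :* b :+ c) :- (a :* d :+ e) := a :* (b :- d) :+ (c :- e))
       refl a _ _ _ _)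
lin-zero (sub-linear l₁ l₂) =
  trans (cong₂ _-_ (lin-zero l₁) (lin-zero l₂)) (solve 0 (con 0ℚ :- con 0ℚ := con 0ℚ) refl)

neg-linear : ∀ {k} {L : (Fin k → ℚ) → ℚ} → Linear L → Linear (λ v → - L v)
lin-cong (neg-linear l) h = cong -_ (lin-cong l h)
lin-comb (neg-linear l) a u v =
  trans (cong -_ (lin-comb l a u v))
    (solve 3 (λ a b c → :- (a :* b :+ c) := a :* (:- b) :+ (:- c)) refl a _ _)
lin-zero (neg-linear l) = cong -_ (lin-zero l)

scaleʳ-linear : ∀ {k} {L : (Fin k → ℚ) → ℚ} → Linear L → ∀ p → Linear (λ v → L v * p)
lin-cong (scaleʳ-linear l p) h = cong (_* p) (lin-cong l h)
lin-comb (scaleʳ-linear l p) a u v =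
  trans (cong (_* p) (lin-comb l a u v))
    (solve 4 (λ a b c p → (a :* b :+ c) :* p := a :* (b :* p) :+ c :* p) refl a _ _ p)
lin-zero (scaleʳ-linear l p) = trans (cong (_* p) (lin-zero l)) (ℚP.*-zeroˡ p)

scaleˡ-linear : ∀ {k} {L : (Fin k → ℚ) → ℚ} → Linear L → ∀ p → Linear (λ v → p * L v)
lin-cong (scaleˡ-linear l p) h = cong (p *_) (lin-cong l h)
lin-comb (scaleˡ-linear l p) a u v =
  trans (cong (p *_) (lin-comb l a u v))
    (solve 4 (λ a b c p → p :* (a :* b :+ c) := a :* (p :* b) :+ p :* c) refl a _ _ p)
lin-zero (scaleˡ-linear l p) = trans (cong (p *_) (lin-zero l)) (ℚP.*-zeroʳ p)

LinearMap : ∀ {k} → ((Fin k → ℚ) → (Fin k → ℚ)) → Set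
LinearMap G = ∀ i → Linear (λ v → G v i)

∘-linear : ∀ {k} {L} {G : (Fin k → ℚ) → (Fin k → ℚ)} → Linear L → LinearMap G → Linear (λ v → L (G v))
lin-cong (∘-linear l g) h = lin-cong l (λ i → lin-cong (g i) h)
lin-comb (∘-linear l g) a u v = trans (lin-cong l (λ i → lin-comb (g i) a u v)) (lin-comb l a _ _)
lin-zero (∘-linear l g) = trans (lin-cong l (λ i → lin-zero (g i))) (lin-zero l)

module KLinearity (n : ℕ) (f : Fin (suc n) → ℤ) where
  open Form n f

  combK : ∀ {m} → (Fin m → ℚ) → (Fin m → K) → K
  combK x γ i = x ∙ (λ j → γ j i)

  mulθ-linear : LinearMap mulθ
  mulθ-linear i =
    sub-linear (if-linear (toℕ i ℕ.≡ᵇ 0) zero-linear (at-linear (toℕ i ∸ 1)))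
               (scaleʳ-linear (at-linear (n ∸ 1)) _)

  iterθ-linear : ∀ q → LinearMap (iterθ q)
  iterθ-linear zero i = proj-linear i
  iterθ-linear (suc q) i = ∘-linear (mulθ-linear i) (iterθ-linear q)

  φ₁-linear : Linear φ₁
  φ₁-linear = scaleʳ-linear (at-linear (n ∸ 1)) _

  φ₂-linear : Linear φ₂
  φ₂-linear =
    neg-linear (scaleʳ-linear
      (sub-linear (at-linear (n ∸ 2))
                  (scaleˡ-linear (scaleʳ-linear (at-linear (n ∸ 1)) (inv (fq 0))) (fq 1)))
      (inv (fq 0)))

  *K-cong : ∀ {a a' b b' : K} → a ≈ a' → b ≈ b' → (a *K b) ≈ (a' *K b')
  *K-cong {a' = a'} a≈a' b≈b' i =
    trans (∙-congˡ _ a≈a') (∙-congʳ a' (λ j → lin-cong (iterθ-linear (toℕ j) i) b≈b'))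

  *K-combˡ : ∀ {m} (c : Fin m → ℚ) (b : Fin m → K) (w : K) →
    (combK c b *K w) ≈ combK c (λ k → b k *K w)
  *K-combˡ c b w i = ∙-assoc c b (λ q → iterθ (toℕ q) w i)

  *K-combʳ : ∀ {m} (a : K) (x : Fin m → ℚ) (γ : Fin m → K) →
    (a *K combK x γ) ≈ combK x (λ j → a *K γ j)
  *K-combʳ a x γ i = begin
    a ∙ (λ q → iterθ (toℕ q) (combK x γ) i)       ≡⟨ ∙-congʳ a (λ q → linear-∙ (iterθ-linear (toℕ q) i) x γ) ⟩
    a ∙ (λ q → x ∙ (λ j → iterθ (toℕ q) (γ j) i))  ≡⟨ ∙-exchange a x (λ j q → iterθ (toℕ q) (γ j) i) ⟩
    x ∙ (λ j → (a *K γ j) i)                      ∎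

  Equivariant : ∀ {m} → (Fin n → Fin m → Fin m → ℤ) → (Fin m → K) → Set
  Equivariant act γ = ∀ k j → combK (λ p → ι (act k j p)) γ ≈ (bR k *K γ j)

  equivariant-extends : ∀ {m} (act : Fin n → Fin m → Fin m → ℤ) (γ : Fin m → K) →
    Equivariant act γ → ∀ c x → combK (actℚ act c x) γ ≈ (toKℚ c *K combK x γ)
  equivariant-extends act γ equiv c x i = begin
    (λ p → c ∙ (λ k → x ∙ (λ j → ι (act k j p)))) ∙ γ·i
      ≡⟨ ∙-assoc c _ γ·i ⟩
    c ∙ (λ k → (λ p → x ∙ (λ j → ι (act k j p))) ∙ γ·i)
      ≡⟨ ∙-congʳ c (λ k → ∙-assoc x _ γ·i) ⟩
    c ∙ (λ k → x ∙ (λ j → combK (λ p → ι (act k j p)) γ i))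
      ≡⟨ ∙-congʳ c (λ k → ∙-congʳ x (λ j → equiv k j i)) ⟩
    c ∙ (λ k → x ∙ (λ j → (bR k *K γ j) i))
      ≡⟨ ∙-congʳ c (λ k → sym (*K-combʳ (bR k) x γ i)) ⟩
    combK c (λ k → bR k *K combK x γ) i
      ≡⟨ sym (*K-combˡ c bR (combK x γ) i) ⟩
    (toKℚ c *K combK x γ) i
      ∎
    where γ·i = λ p → γ p i

module DegreeAtLeastTwo (n' : ℕ) (f : Fin (suc (suc (suc n'))) → ℤ) where
  open Form (suc (suc n')) f
  open KLinearity (suc (suc n')) f

  -- θK has a single nonzero coordinate, 1 at θ¹, so θK * r = θ r.
  θK-mul : ∀ r → (θK *K r) ≈ mulθ r
  θK-mul r i =
    trans (cong (λ rest → 0ℚ * r i + (1ℚ * mulθ r i + rest))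
            (trans (Σ-cong {n'} (λ j → ℚP.*-zeroˡ (iterθ (toℕ (suc (suc j))) r i))) (Σ-zero {n'})))
      (solve 2 (λ a b → con 0ℚ :* a :+ (con 1ℚ :* b :+ con 0ℚ) := b) refl (r i) (mulθ r i))

  θ-acts : ∀ c → toKℚ c ≈ θK → ∀ w → (toKℚ c *K w) ≈ mulθ w
  θ-acts c c≈θ w i = trans (*K-cong c≈θ (λ _ → refl) i) (θK-mul w i)

  mulθ-top : ∀ r → at (mulθ r) 0ℚ (suc n') ≡ at r 0ℚ n' - at r 0ℚ (suc n') * (fq 1 * inv (fq 0))
  mulθ-top r = begin
    at (mulθ r) 0ℚ (suc n')   ≡⟨ at-< (mulθ r) 0ℚ (suc n') top ⟩
    mulθ r (fromℕ< top)       ≡⟨ cong (λ t → (if t ℕ.≡ᵇ 0 then 0ℚ else at r 0ℚ (t ∸ 1))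
                                    - at r 0ℚ (suc n') * (fq (suc (suc n') ∸ t) * inv (fq 0)))
                                  (FinP.toℕ-fromℕ< top) ⟩
    at r 0ℚ n' - at r 0ℚ (suc n') * (fq (suc (suc n') ∸ suc n') * inv (fq 0))
                              ≡⟨ cong (λ t → at r 0ℚ n' - at r 0ℚ (suc n') * (fq t * inv (fq 0)))
                                   (ℕP.m+n∸n≡m 1 n') ⟩
    at r 0ℚ n' - at r 0ℚ (suc n') * (fq 1 * inv (fq 0))  ∎
    where top = ℕP.n<1+n (suc n')

  φ₁∘θ : ∀ r → φ₁ (mulθ r) ≡ - φ₂ r
  φ₁∘θ r =
    trans (cong (_* inv (fq 0)) (mulθ-top r))
      (solve 4 (λ a b F I → (a :- b :* (F :* I)) :* I := :- (:- ((a :- F :* (b :* I)) :* I)))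
         refl (at r 0ℚ n') (at r 0ℚ (suc n')) (fq 1) (inv (fq 0)))

  θ-relation : ∀ {m} (act : Fin (suc (suc n')) → Fin m → Fin m → ℤ) (γ : Fin m → K) →
    Equivariant act γ → ∀ c → toKℚ c ≈ θK → ∀ x →
    actℚ act c x ∙ (λ p → φ₁ (γ p)) ≡ - (x ∙ (λ j → φ₂ (γ j)))
  θ-relation act γ equiv c c≈θ x = begin
    actℚ act c x ∙ (λ p → φ₁ (γ p))   ≡⟨ sym (linear-∙ φ₁-linear (actℚ act c x) γ) ⟩
    φ₁ (combK (actℚ act c x) γ)       ≡⟨ lin-cong φ₁-linear (λ i →
                                           trans (equivariant-extends act γ equiv c x i)
                                                 (θ-acts c c≈θ (combK x γ) i)) ⟩
    φ₁ (mulθ (combK x γ))             ≡⟨ φ₁∘θ (combK x γ) ⟩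
    - φ₂ (combK x γ)                  ≡⟨ cong -_ (linear-∙ φ₂-linear x γ) ⟩
    - (x ∙ (λ j → φ₂ (γ j)))          ∎

-- In a based balanced pair, the columns (β_{p,q})_p and the rows
-- (β_{q,p})_p of the pairing matrix are equivariant families for the
-- actions on M and on N respectively; this is R_f-balancedness on bases.

module BalancedPairEquivariance (n : ℕ) (f : Fin (suc n) → ℤ) {m} (P : Form.BasedBalancedPair n f m) where
  open Form n f
  open BasedBalancedPair P
  open KLinearity n f

  ιv : ∀ {k} → (Fin k → ℤ) → Fin k → ℚ
  ιv x j = ι (x j)

  B-as-dot : ∀ x y i → B x y i ≡ x ∙ (λ j → y ∙ (λ k → β j k i))
  B-as-dot x y i = Σ-cong (λ j → Σ-*ˡ (x j) (λ k → y k * β j k i))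

  B-column : ∀ x q i → B x (ιv (e q)) i ≡ x ∙ (λ j → β j q i)
  B-column x q i = trans (B-as-dot x (ιv (e q)) i) (∙-congʳ x (λ j → ∙-e q (λ k → β j k i)))

  B-row : ∀ q y i → B (ιv (e q)) y i ≡ y ∙ (λ k → β q k i)
  B-row q y i = trans (B-as-dot (ιv (e q)) y i) (∙-e q (λ j → y ∙ (λ k → β j k i)))

  toK-e : ∀ k → toK (e k) ≈ bR k
  toK-e k i = ∙-e k (λ k' → bR k' i)

  act-e : ∀ (act : Fin n → Fin m → Fin m → ℤ) k j → actℤ act (e k) (e j) ≈ (λ p → ι (act k j p))
  act-e act k j p =
    trans (∙-congʳ (λ k' → ι (e k k')) (λ k' → ∙-e j (λ j' → ι (act k' j' p)))) (∙-e k (λ k' → ι (act k' j p)))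

  columns-equivariant : ∀ q → Equivariant actM (λ p i → β p q i)
  columns-equivariant q k j i = begin
    combK (λ p → ι (actM k j p)) column i     ≡⟨ sym (∙-congˡ _ (act-e actM k j)) ⟩
    combK (actℤ actM (e k) (e j)) column i     ≡⟨ sym (B-column (actℤ actM (e k) (e j)) q i) ⟩
    B (actℤ actM (e k) (e j)) (ιv (e q)) i     ≡⟨ linM (e k) (e j) (e q) i ⟩
    (toK (e k) *K B (ιv (e j)) (ιv (e q))) i    ≡⟨ *K-cong (toK-e k) (λ i' →
                                                    trans (B-column (ιv (e j)) q i') (∙-e j (λ p → β p q i'))) i ⟩
    (bR k *K column j) i                       ∎
    where column = λ p i → β p q i

  rows-equivariant : ∀ q → Equivariant actN (β q)
  rows-equivariant q k j i = begin
    combK (λ p → ι (actN k j p)) (β q) i       ≡⟨ sym (∙-congˡ _ (act-e actN k j)) ⟩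
    combK (actℤ actN (e k) (e j)) (β q) i       ≡⟨ sym (B-row q (actℤ actN (e k) (e j)) i) ⟩
    B (ιv (e q)) (actℤ actN (e k) (e j)) i      ≡⟨ linN (e k) (e q) (e j) i ⟩
    (toK (e k) *K B (ιv (e q)) (ιv (e j))) i     ≡⟨ *K-cong (toK-e k) (λ i' →
                                                     trans (B-row q (ιv (e j)) i') (∙-e j (λ p → β q p i'))) i ⟩
    (bR k *K β q j) i                          ∎

proposition3p5 : ∀ (n : ℕ) → 2 ≤ n → (f : Fin (suc n) → ℤ) → f zero ≢ 0ℤ →
    ∀ (m : ℕ) (P : Form.BasedBalancedPair n f m) →
    let open Form n f
        open BasedBalancedPair P
        f₀ = ι (f zero)
    in ∀ (A₁⁻¹ : Mat m m) → (A₁ · A₁⁻¹) ≈₂ δ → (A₁⁻¹ · A₁) ≈₂ δ →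
       ∀ (c : Fin n → ℚ) → (∀ k → InZinv f₀ (c k)) → toKℚ c ≈ θK →
       (∀ (x : Fin m → ℚ) → (∀ j → InZinv f₀ (x j)) →
          actℚ actM c x ≈ (λ l → Σℚ (λ j → x j * (- (A₂ · A₁⁻¹) j l))))
       ×
       (∀ (y : Fin m → ℚ) → (∀ k → InZinv f₀ (y k)) →
          actℚ actN c y ≈ (λ l → Σℚ (λ k → (- (A₁⁻¹ · A₂) l k) * y k)))
proposition3p5 _ (s≤s (s≤s (z≤n {n'}))) f _ m P A₁⁻¹ A₁A₁⁻¹≈1 A₁⁻¹A₁≈1 c _ c≈θ =
  (λ x _ → row-solve A₁ A₂ A₁⁻¹ A₁A₁⁻¹≈1 x (actℚ actM c x) (θ-on-M x)) ,
  (λ y _ → column-solve A₁ A₂ A₁⁻¹ A₁⁻¹A₁≈1 y (actℚ actN c y) (θ-on-N y))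
  where
  open Form (suc (suc n')) f
  open BasedBalancedPair P
  open DegreeAtLeastTwo n' f
  open BalancedPairEquivariance (suc (suc n')) f P

  θ-on-M : ∀ x → (actℚ actM c x ⊙ A₁) ≈ (λ q → - (x ⊙ A₂) q)
  θ-on-M x q = θ-relation actM (λ p i → β p q i) (columns-equivariant q) c c≈θ x

  θ-on-N : ∀ y → (A₁ ⊛ actℚ actN c y) ≈ (λ q → - (A₂ ⊛ y) q)
  θ-on-N y q = begin
    A₁ q ∙ actℚ actN c y       ≡⟨ ∙-comm (A₁ q) _ ⟩
    actℚ actN c y ∙ A₁ q       ≡⟨ θ-relation actN (β q) (rows-equivariant q) c c≈θ y ⟩
    - (y ∙ A₂ q)               ≡⟨ cong -_ (∙-comm y (A₂ q)) ⟩
    - (A₂ q ∙ y)               ∎
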